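{- Let $c\in\mathbb{F}_q[t]\setminus\{0\}$ and let $B=B_\kappa(\Gamma)$ be a Bohr set of width $k$ such that $B\subset G_{N-\deg c}$. Then the dilate $c\cdot B=\{cx:x\in B\}$ is a Bohr set (in $G=G_N$) with rank at most $\mathrm{rk}(B)+q^{\deg c}$ and width $k$.
   Context: Let $q$ be a power of a prime $p$ and $N$ a positive integer. For an integer $m$, $G_m$ denotes the set of polynomials in $\mathbb{F}_q[t]$ of degree strictly less than $m$, and $G=G_N$. For $x=\sum_{i<M}a_it^i\in\mathbb{F}_q((1/t))$ write $\{x\}=\sum_{i<0}a_it^i$. Let $\mathbb{T}=\{\sum_{i<0}a_it^i: a_i\in\mathbb{F}_q\}$. For a finite set $\Gamma\subset\mathbb{T}$ and $\kappa:\Gamma\to\mathbb{N}$, the Bohr set is $B_\kappa(\Gamma)=\{x\in G:\deg\{x\xi\}<-\kappa(\xi)\text{ for all }\xi\in\Gamma\}$; a Bohr set is any set of this form, its rank $\mathrm{rk}(B)$ is $|\Gamma|$ and its width is $\max_{\xi\in\Gamma}\kappa(\xi)$ (for the given representation; "a Bohr set with rank at most $r$" means it admits such a representation with $|\Gamma|\le r$). -}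

module Defs where

open import Level using (0ℓ)
open import Algebra.Bundles using (CommutativeRing)
open import Data.Nat using (ℕ; zero; suc; _+_; _∸_; _≤_; _<_; _⊔_; _≤?_)
open import Data.Nat.Properties using (≤-refl)
open import Data.Fin using (Fin; toℕ; fromℕ; fromℕ<) renaming (zero to fz; suc to fs)
open import Data.Product using (∃; _×_)
open import Data.Bool using (if_then_else_)
open import Relation.Nullary using (¬_; does; yes; no)
open import Relation.Binary.PropositionalEquality using (_≡_)

record FiniteField (q : ℕ) : Set₁ where
  field
    commRing : CommutativeRing 0ℓ 0ℓ
  open CommutativeRing commRing public
  field
    0≉1       : ¬ (0# ≈ 1#)
    inverse   : ∀ x → ¬ (x ≈ 0#) → ∃ λ y → x * y ≈ 1#
    enum      : Fin q → Carrier
    enum-inj  : ∀ i j → enum i ≈ enum j → i ≡ j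
    enum-surj : ∀ x → ∃ λ i → enum i ≈ x

maxFin : ∀ n → (Fin n → ℕ) → ℕ
maxFin zero    f = 0
maxFin (suc n) f = f fz ⊔ maxFin n (λ i → f (fs i))

module Bohr {q : ℕ} (F : FiniteField q) (N : ℕ) where
  open FiniteField F using (Carrier; _≈_; 0#) renaming (_+_ to _+F_; _*_ to _*F_)

  ∑ : ∀ n → (Fin n → Carrier) → Carrier
  ∑ zero    f = 0#
  ∑ (suc n) f = f fz +F ∑ n (λ i → f (fs i))

  -- G_m : polynomials of degree < m, given by their coefficients a_0 … a_{m-1}
  Poly : ℕ → Set
  Poly m = Fin m → Carrier

  G : Set
  G = Poly N

  -- 𝕋 : ξ = Σ_{i<0} a_i t^i, represented by ξ n = a_{-(n+1)} (coefficient of t^{-(n+1)})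
  𝕋 : Set
  𝕋 = ℕ → Carrier

  -- coefficient of t^{-(l+1)} in {x ξ} for x ∈ G, ξ ∈ 𝕋
  fracCoeff : G → 𝕋 → ℕ → Carrier
  fracCoeff x ξ l = ∑ N (λ i → x i *F ξ (toℕ i + l))

  -- deg {x ξ} < -κ  (with deg 0 = -∞): coefficients of t^{-1},…,t^{-κ} vanish
  degFracBelow : G → 𝕋 → ℕ → Set
  degFracBelow x ξ κ = ∀ l → l < κ → fracCoeff x ξ l ≈ 0#

  InBohr : (r : ℕ) → (Fin r → 𝕋) → (Fin r → ℕ) → G → Set
  InBohr r Γ κ x = ∀ s → degFracBelow x (Γ s) (κ s)

  width : (r : ℕ) → (Fin r → ℕ) → ℕ
  width r κ = maxFin r κ

  InG : ℕ → G → Set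
  InG m x = ∀ (i : Fin N) → m ≤ toℕ i → x i ≈ 0#

  -- coefficient of t^m of x ∈ G, with 0 outside range
  coeff : G → ℕ → Carrier
  coeff x m with suc m ≤? N
  ... | yes p = x (fromℕ< p)
  ... | no  _ = 0#

  NonzeroOfDeg : (d : ℕ) → Poly (suc d) → Set
  NonzeroOfDeg d c = ¬ (c (fromℕ d) ≈ 0#)

  mul : (d : ℕ) → Poly (suc d) → G → G
  mul d c x n = ∑ (suc d) (λ i →
    if does (toℕ i ≤? toℕ n) then c i *F coeff x (toℕ n ∸ toℕ i) else 0#)

module Submission where

open import Defs
open import Data.Nat using (ℕ; suc; _+_; _∸_; _^_; _≤_)
open import Data.Nat.Primality using (Prime)
open import Data.Fin using (Fin)
open import Data.Product using (Σ; ∃; _×_)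
open import Function.Bundles using (_⇔_)
open import Relation.Binary.PropositionalEquality using (_≡_)

open import Level using (Level)
import Level
open import Algebra.Bundles using (CommutativeRing)
open import Data.Nat using (zero; _<_; _⊔_; z≤n; s≤s; _≤?_; _<?_; _≟_)
open import Data.Nat.Base using (nonTrivial⇒n>1)
import Data.Nat.Properties as ℕP
open import Data.Nat.Primality using (prime⇒nonTrivial)
open import Data.Fin using (toℕ; fromℕ; fromℕ<; splitAt; _↑ˡ_; _↑ʳ_) renaming (zero to fz; suc to fs)
import Data.Fin.Properties as FinP
open import Data.Vec.Functional using (_++_; replicate)
open import Data.Vec.Functional.Properties using (lookup-++ˡ; lookup-++ʳ)
open import Data.Sum using (inj₁; inj₂)
open import Data.Product using (_,_; proj₁; proj₂)
open import Data.Bool using (true; false; if_then_else_)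
open import Function using (_∘_)
open import Function.Bundles using (mk⇔; Equivalence)
open import Relation.Nullary using (¬_; does; yes; no; contradiction)
open import Relation.Nullary.Decidable using (dec-true; dec-false)
open import Relation.Binary.PropositionalEquality as ≡ using (_≢_)
open import Algebra.Properties.CommutativeSemigroup ℕP.+-commutativeSemigroup
  using () renaming (xy∙z≈xz∙y to +-right-comm)

-- Write c = Σ_{i ≤ d} c_i t^i with c_d ≠ 0 and represent polynomials and
-- elements of 𝕋 by coefficient sequences.  Multiplication by c on polynomials is
-- adjoint to ξ ↦ {cξ} on 𝕋: {(cx)ξ} = {x{cξ}} below degree 0 when deg cx < N
-- ('adjoint').  As c_d is invertible, the recurrence {cξ} = γ can be solved
-- with arbitrary initial values ξ_0, …, ξ_{d-1} ('Recurrence'); this gives a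
-- preimage ξ′ of each frequency γ and a basis η_0, …, η_{d-1} of the kernel
-- ('basis').  By long division, a polynomial of degree < N is c·x with
-- deg x < N - d iff it is orthogonal to every η_b ('divisible').  Hence c·B is
-- the Bohr set with frequencies ξ′_s (radius κ_s) and η_b (radius k), of rank
-- r + d ≤ r + q^d and width k ('dilate-Bohr'); the radius k ≥ 1 needed for the
-- η_b is automatic when d ≥ 1 because a Bohr set of width 0 is all of G.

∸≡⇒≡+ : ∀ {i n s} → i ≤ n → n ∸ i ≡ s → n ≡ s + i
∸≡⇒≡+ {i} i≤n ≡.refl = ≡.sym (ℕP.m∸n+n≡m i≤n)

<-pow : ∀ q → 1 < q → ∀ d → d < q ^ d
<-pow q 1<q zero    = s≤s z≤n
<-pow q 1<q (suc d) = ℕP.≤-<-trans (<-pow q 1<q d) (ℕP.^-monoʳ-< q 1<q (ℕP.n<1+n d))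

module Sequences {a ℓ : Level} (R : CommutativeRing a ℓ) where
  open CommutativeRing R renaming (_+_ to _⊕_; _*_ to _⊗_)
  open import Algebra.Properties.Semiring.Sum semiring
    using (sum; sum-cong-≋; sum-cong-≗; sum-replicate-zero; sum-init-last;
           ∑-distrib-+; ∑-comm; *-distribˡ-sum; *-distribʳ-sum)
  open import Relation.Binary.Reasoning.Setoid setoid

  sumTo : ℕ → (ℕ → Carrier) → Carrier
  sumTo n f = sum (λ (i : Fin n) → f (toℕ i))

  sumTo-cong : ∀ n {f g : ℕ → Carrier} → (∀ i → i < n → f i ≈ g i) → sumTo n f ≈ sumTo n g
  sumTo-cong n f≈g = sum-cong-≋ (λ i → f≈g (toℕ i) (FinP.toℕ<n i))

  sumTo-cong-≡ : ∀ n {f g : ℕ → Carrier} → (∀ i → f i ≡ g i) → sumTo n f ≡ sumTo n g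
  sumTo-cong-≡ n f≡g = sum-cong-≗ {n} (λ i → f≡g (toℕ i))

  sumTo-zero : ∀ n {f : ℕ → Carrier} → (∀ i → i < n → f i ≈ 0#) → sumTo n f ≈ 0#
  sumTo-zero n f≈0 = trans (sumTo-cong n f≈0) (sum-replicate-zero n)

  sumTo-+ : ∀ n (f g : ℕ → Carrier) → sumTo n (λ i → f i ⊕ g i) ≈ sumTo n f ⊕ sumTo n g
  sumTo-+ n f g = ∑-distrib-+ {n} (λ i → f (toℕ i)) (λ i → g (toℕ i))

  sumTo-*ˡ : ∀ n a (f : ℕ → Carrier) → a ⊗ sumTo n f ≈ sumTo n (λ i → a ⊗ f i)
  sumTo-*ˡ n a f = *-distribˡ-sum {n} a (λ i → f (toℕ i))

  sumTo-*ʳ : ∀ n a (f : ℕ → Carrier) → sumTo n f ⊗ a ≈ sumTo n (λ i → f i ⊗ a)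
  sumTo-*ʳ n a f = *-distribʳ-sum {n} a (λ i → f (toℕ i))

  sumTo-comm : ∀ m n (f : ℕ → ℕ → Carrier) →
               sumTo m (λ i → sumTo n (f i)) ≈ sumTo n (λ j → sumTo m (λ i → f i j))
  sumTo-comm m n f = ∑-comm {m} {n} (λ i j → f (toℕ i) (toℕ j))

  sumTo-snoc : ∀ n (f : ℕ → Carrier) → sumTo (suc n) f ≈ sumTo n f ⊕ f n
  sumTo-snoc n f = trans (sum-init-last {n} (λ i → f (toℕ i)))
    (+-cong (reflexive (sum-cong-≗ {n} (λ i → ≡.cong f (FinP.toℕ-inject₁ i))))
            (reflexive (≡.cong f (FinP.toℕ-fromℕ n))))

  sumTo-single : ∀ n (f : ℕ → Carrier) i₀ → i₀ < n →
                 (∀ i → i < n → i ≢ i₀ → f i ≈ 0#) → sumTo n f ≈ f i₀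
  sumTo-single (suc n) f zero _ others = begin
    f 0 ⊕ sumTo n (λ i → f (suc i)) ≈⟨ +-congˡ (sumTo-zero n (λ i i<n → others (suc i) (s≤s i<n) λ ())) ⟩
    f 0 ⊕ 0#                        ≈⟨ +-identityʳ _ ⟩
    f 0                             ∎
  sumTo-single (suc n) f (suc i₀) (s≤s i₀<n) others = begin
    f 0 ⊕ sumTo n (λ i → f (suc i))
      ≈⟨ +-cong (others 0 (s≤s z≤n) λ ())
                (sumTo-single n _ i₀ i₀<n (λ i i<n i≢i₀ → others (suc i) (s≤s i<n) (i≢i₀ ∘ ℕP.suc-injective))) ⟩
    0# ⊕ f (suc i₀) ≈⟨ +-identityˡ _ ⟩
    f (suc i₀)      ∎

  guard : ℕ → ℕ → Carrier → Carrier
  guard m j a = if does (m ≤? j) then a else 0#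

  guard-≤ : ∀ {m j} a → m ≤ j → guard m j a ≡ a
  guard-≤ {m} {j} a m≤j rewrite dec-true (m ≤? j) m≤j = ≡.refl

  guard-> : ∀ {m j} a → j < m → guard m j a ≡ 0#
  guard-> {m} {j} a j<m rewrite dec-false (m ≤? j) (ℕP.<⇒≱ j<m) = ≡.refl

  guard-suc : ∀ m j a → guard (suc m) (suc j) a ≡ guard m j a
  guard-suc m j a with m ≤? j
  ... | yes m≤j = ≡.trans (guard-≤ a (s≤s m≤j)) (≡.sym (guard-≤ a m≤j))
  ... | no  m≰j = ≡.trans (guard-> a (s≤s (ℕP.≰⇒> m≰j))) (≡.sym (guard-> a (ℕP.≰⇒> m≰j)))

  guard-cong : ∀ m j {a b} → a ≈ b → guard m j a ≈ guard m j b
  guard-cong m j a≈b with does (m ≤? j)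
  ... | true  = a≈b
  ... | false = refl

  guard-0 : ∀ m j {a} → a ≈ 0# → guard m j a ≈ 0#
  guard-0 m j a≈0 with does (m ≤? j)
  ... | true  = a≈0
  ... | false = refl

  guard-⊕ : ∀ m j a b → guard m j (a ⊕ b) ≈ guard m j a ⊕ guard m j b
  guard-⊕ m j a b with does (m ≤? j)
  ... | true  = refl
  ... | false = sym (+-identityˡ 0#)

  guard-⊗ : ∀ m j a b → guard m j a ⊗ b ≈ guard m j (a ⊗ b)
  guard-⊗ m j a b with does (m ≤? j)
  ... | true  = refl
  ... | false = zeroˡ b

  sumTo-shift : ∀ m M (F : ℕ → Carrier) → (∀ i → M ∸ m ≤ i → F (i + m) ≈ 0#) →
                sumTo M (λ j → guard m j (F j)) ≈ sumTo M (λ i → F (i + m))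
  sumTo-shift zero M F _ =
    sumTo-cong M (λ i _ → reflexive (≡.cong F (≡.sym (ℕP.+-identityʳ i))))
  sumTo-shift (suc m) zero F _ = refl
  sumTo-shift (suc m) (suc M) F tail≈0 = begin
    guard (suc m) 0 (F 0) ⊕ sumTo M (λ j → guard (suc m) (suc j) (F (suc j)))
      ≈⟨ +-cong (reflexive (guard-> {suc m} (F 0) (s≤s z≤n)))
                (reflexive (sumTo-cong-≡ M (λ j → guard-suc m j (F (suc j))))) ⟩
    0# ⊕ sumTo M (λ j → guard m j (F (suc j)))
      ≈⟨ +-identityˡ _ ⟩
    sumTo M (λ j → guard m j (F (suc j)))
      ≈⟨ sumTo-shift m M (λ j → F (suc j)) (λ i p → trans (reflexive (≡.cong F (≡.sym (ℕP.+-suc i m)))) (tail≈0 i p)) ⟩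
    sumTo M (λ i → F (suc i + m))
      ≈⟨ reflexive (sumTo-cong-≡ M (λ i → ≡.cong F (≡.sym (ℕP.+-suc i m)))) ⟩
    sumTo M (λ i → F (i + suc m))
      ≈⟨ sym (+-identityʳ _) ⟩
    sumTo M (λ i → F (i + suc m)) ⊕ 0#
      ≈⟨ +-congˡ (sym (tail≈0 M (ℕP.m∸n≤m M m))) ⟩
    sumTo M (λ i → F (i + suc m)) ⊕ F (M + suc m)
      ≈⟨ sym (sumTo-snoc M (λ i → F (i + suc m))) ⟩
    sumTo (suc M) (λ i → F (i + suc m)) ∎

  Supp : ℕ → (ℕ → Carrier) → Set ℓ
  Supp M X = ∀ j → M ≤ j → X j ≈ 0#

  -- coefficient of t^{-(l+1)} in {X·ξ} when deg X < M
  pair : ℕ → (ℕ → Carrier) → (ℕ → Carrier) → ℕ → Carrier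
  pair M X ξ l = sumTo M (λ j → X j ⊗ ξ (j + l))

  pair-cong : ∀ M {X Y} ξ l → (∀ j → j < M → X j ≈ Y j) → pair M X ξ l ≈ pair M Y ξ l
  pair-cong M ξ l X≈Y = sumTo-cong M (λ j j<M → *-congʳ {ξ (j + l)} (X≈Y j j<M))

  pair-⊕ : ∀ M X Y ξ l → pair M (λ j → X j ⊕ Y j) ξ l ≈ pair M X ξ l ⊕ pair M Y ξ l
  pair-⊕ M X Y ξ l = trans (sumTo-cong M (λ j _ → distribʳ (ξ (j + l)) (X j) (Y j)))
                           (sumTo-+ M (λ j → X j ⊗ ξ (j + l)) (λ j → Y j ⊗ ξ (j + l)))

  pair-congʳ : ∀ M X {ξ ζ} l → (∀ n → ξ n ≈ ζ n) → pair M X ξ l ≈ pair M X ζ l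
  pair-congʳ M X l ξ≈ζ = sumTo-cong M (λ j _ → *-congˡ {X j} (ξ≈ζ (j + l)))

  pair-zeroʳ : ∀ M X ξ l → (∀ n → ξ n ≈ 0#) → pair M X ξ l ≈ 0#
  pair-zeroʳ M X ξ l ξ≈0 = sumTo-zero M (λ j _ → trans (*-congˡ (ξ≈0 (j + l))) (zeroʳ (X j)))

module Multiplication {a ℓ : Level} (R : CommutativeRing a ℓ) (d : ℕ)
                      (c : ℕ → CommutativeRing.Carrier R) where
  open CommutativeRing R renaming (_+_ to _⊕_; _*_ to _⊗_)
  open Sequences R
  open import Algebra.Properties.CommutativeSemigroup *-commutativeSemigroup using (xy∙z≈y∙xz)
  open import Relation.Binary.Reasoning.Setoid setoid

  mulPoly : (ℕ → Carrier) → ℕ → Carrier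
  mulPoly X n = sumTo (suc d) (λ i → guard i n (c i ⊗ X (n ∸ i)))

  -- coefficient of t^{-(n+1)} in {c·ξ}
  mulTail : (ℕ → Carrier) → ℕ → Carrier
  mulTail ξ n = sumTo (suc d) (λ m → c m ⊗ ξ (n + m))

  adjoint : ∀ M X ξ l → Supp (M ∸ d) X → pair M (mulPoly X) ξ l ≈ pair M X (mulTail ξ) l
  adjoint M X ξ l X-deg = begin
    sumTo M (λ j → mulPoly X j ⊗ ξ (j + l))
      ≈⟨ sumTo-cong M (λ j _ → trans (sumTo-*ʳ (suc d) (ξ (j + l)) (λ m → guard m j (c m ⊗ X (j ∸ m))))
                                       (sumTo-cong (suc d) (λ m _ → guard-⊗ m j (c m ⊗ X (j ∸ m)) (ξ (j + l))))) ⟩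
    sumTo M (λ j → sumTo (suc d) (λ m → guard m j (term m j)))
      ≈⟨ sumTo-comm M (suc d) (λ j m → guard m j (term m j)) ⟩
    sumTo (suc d) (λ m → sumTo M (λ j → guard m j (term m j)))
      ≈⟨ sumTo-cong (suc d) (λ m m≤d → trans (sumTo-shift m M (term m) (shifted-tail m m≤d))
                                             (sumTo-cong M (λ i _ → shifted m i))) ⟩
    sumTo (suc d) (λ m → sumTo M (λ i → X i ⊗ (c m ⊗ ξ (i + l + m))))
      ≈⟨ sym (sumTo-comm M (suc d) (λ i m → X i ⊗ (c m ⊗ ξ (i + l + m)))) ⟩
    sumTo M (λ i → sumTo (suc d) (λ m → X i ⊗ (c m ⊗ ξ (i + l + m))))
      ≈⟨ sumTo-cong M (λ i _ → sym (sumTo-*ˡ (suc d) (X i) (λ m → c m ⊗ ξ (i + l + m)))) ⟩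
    sumTo M (λ i → X i ⊗ mulTail ξ (i + l)) ∎
    where
    term : ℕ → ℕ → Carrier
    term m j = (c m ⊗ X (j ∸ m)) ⊗ ξ (j + l)

    shifted : ∀ m i → term m (i + m) ≈ X i ⊗ (c m ⊗ ξ (i + l + m))
    shifted m i = begin
      (c m ⊗ X (i + m ∸ m)) ⊗ ξ (i + m + l) ≈⟨ *-cong (*-congˡ (reflexive (≡.cong X (ℕP.m+n∸n≡m i m))))
                                                       (reflexive (≡.cong ξ (+-right-comm i m l))) ⟩
      (c m ⊗ X i) ⊗ ξ (i + l + m)           ≈⟨ xy∙z≈y∙xz _ _ _ ⟩
      X i ⊗ (c m ⊗ ξ (i + l + m))           ∎

    shifted-tail : ∀ m → m < suc d → ∀ i → M ∸ m ≤ i → term m (i + m) ≈ 0#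
    shifted-tail m (s≤s m≤d) i M∸m≤i = begin
      term m (i + m)               ≈⟨ shifted m i ⟩
      X i ⊗ (c m ⊗ ξ (i + l + m))  ≈⟨ *-congʳ (X-deg i (ℕP.≤-trans (ℕP.∸-monoʳ-≤ M m≤d) M∸m≤i)) ⟩
      0# ⊗ _                       ≈⟨ zeroˡ _ ⟩
      0#                           ∎

  mulPoly-cong : ∀ {X Y} → (∀ j → X j ≈ Y j) → ∀ n → mulPoly X n ≈ mulPoly Y n
  mulPoly-cong X≈Y n = sumTo-cong (suc d) (λ i _ → guard-cong i n (*-congˡ {c i} (X≈Y (n ∸ i))))

  mulPoly-⊕ : ∀ X Y n → mulPoly (λ j → X j ⊕ Y j) n ≈ mulPoly X n ⊕ mulPoly Y n
  mulPoly-⊕ X Y n = trans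
    (sumTo-cong (suc d) (λ i _ → trans (guard-cong i n (distribˡ (c i) (X (n ∸ i)) (Y (n ∸ i))))
                                       (guard-⊕ i n (c i ⊗ X (n ∸ i)) (c i ⊗ Y (n ∸ i)))))
    (sumTo-+ (suc d) (λ i → guard i n (c i ⊗ X (n ∸ i))) (λ i → guard i n (c i ⊗ Y (n ∸ i))))

  mulPoly-zero : ∀ n → mulPoly (λ _ → 0#) n ≈ 0#
  mulPoly-zero n = sumTo-zero (suc d) (λ i _ → guard-0 i n (zeroʳ (c i)))

  monomial : ℕ → Carrier → ℕ → Carrier
  monomial s b n = if does (n ≟ s) then b else 0#

  monomial-at : ∀ s b → monomial s b s ≡ b
  monomial-at s b rewrite dec-true (s ≟ s) ≡.refl = ≡.refl

  monomial-off : ∀ s n b → n ≢ s → monomial s b n ≡ 0#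
  monomial-off s n b n≢s rewrite dec-false (n ≟ s) n≢s = ≡.refl

  monomial-supp : ∀ s b → Supp (suc s) (monomial s b)
  monomial-supp s b j s<j = reflexive (monomial-off s j b (λ j≡s → ℕP.<-irrefl (≡.sym j≡s) s<j))

  term-0 : ∀ (X : ℕ → Carrier) i n → X (n ∸ i) ≈ 0# → guard i n (c i ⊗ X (n ∸ i)) ≈ 0#
  term-0 X i n X≈0 = guard-0 i n {c i ⊗ X (n ∸ i)} (trans (*-congˡ {c i} X≈0) (zeroʳ (c i)))

  mulPoly-monomial-top : ∀ s b → mulPoly (monomial s b) (s + d) ≈ c d ⊗ b
  mulPoly-monomial-top s b = begin
    mulPoly (monomial s b) (s + d)                   ≈⟨ sumTo-single (suc d) (λ i → guard i (s + d) (c i ⊗ monomial s b (s + d ∸ i))) d (ℕP.n<1+n d) others ⟩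
    guard d (s + d) (c d ⊗ monomial s b (s + d ∸ d)) ≡⟨ guard-≤ (c d ⊗ monomial s b (s + d ∸ d)) (ℕP.m≤n+m d s) ⟩
    c d ⊗ monomial s b (s + d ∸ d)                   ≡⟨ ≡.cong (λ k → c d ⊗ monomial s b k) (ℕP.m+n∸n≡m s d) ⟩
    c d ⊗ monomial s b s                             ≡⟨ ≡.cong (c d ⊗_) (monomial-at s b) ⟩
    c d ⊗ b                                          ∎
    where
    others : ∀ i → i < suc d → i ≢ d → guard i (s + d) (c i ⊗ monomial s b (s + d ∸ i)) ≈ 0#
    others i (s≤s i≤d) i≢d = term-0 (monomial s b) i (s + d) (reflexive (monomial-off s (s + d ∸ i) b (λ s+d∸i≡s →
      i≢d (≡.sym (ℕP.+-cancelˡ-≡ s d i (∸≡⇒≡+ (ℕP.≤-trans i≤d (ℕP.m≤n+m d s)) s+d∸i≡s))))))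

  mulPoly-monomial-above : ∀ s b n → s + d < n → mulPoly (monomial s b) n ≈ 0#
  mulPoly-monomial-above s b n s+d<n = sumTo-zero (suc d) vanish
    where
    vanish : ∀ i → i < suc d → guard i n (c i ⊗ monomial s b (n ∸ i)) ≈ 0#
    vanish i (s≤s i≤d) = term-0 (monomial s b) i n (reflexive (monomial-off s (n ∸ i) b (λ n∸i≡s →
      ℕP.<-irrefl (≡.sym (∸≡⇒≡+ i≤n n∸i≡s)) (ℕP.≤-<-trans (ℕP.+-monoʳ-≤ s i≤d) s+d<n))))
      where i≤n = ℕP.≤-trans i≤d (ℕP.≤-trans (ℕP.m≤n+m d s) (ℕP.<⇒≤ s+d<n))

module DivisionBy {a ℓ : Level} (R : CommutativeRing a ℓ) (d : ℕ)
                  (c : ℕ → CommutativeRing.Carrier R) (c⁻¹ : CommutativeRing.Carrier R)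
                  (c-lead : CommutativeRing._≈_ R (CommutativeRing._*_ R (c d) c⁻¹) (CommutativeRing.1# R)) where
  open CommutativeRing R renaming (_+_ to _⊕_; _*_ to _⊗_)
  open import Algebra.Properties.Group +-group using (x≈y⇒x∙y⁻¹≈ε; //-rightDividesˡ)
  open import Algebra.Properties.CommutativeSemigroup +-commutativeSemigroup using (xy∙z≈xz∙y)
  open Sequences R
  open Multiplication R d c
  open import Relation.Binary.Reasoning.Setoid setoid

  cancel-lead : ∀ z → c d ⊗ (c⁻¹ ⊗ z) ≈ z
  cancel-lead z = trans (sym (*-assoc _ _ _)) (trans (*-congʳ c-lead) (*-identityˡ z))

  -- The recurrence mulTail ξ = g determines ξ (n + d) from ξ n, …, ξ (n + d - 1);
  -- so it has a solution with arbitrary initial values ξ 0, …, ξ (d - 1).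
  module Recurrence (init g : ℕ → Carrier) where
    -- the value of ξ (n + d) forced by ξ (n + m) = w m for m < d
    forced : ℕ → (ℕ → Carrier) → Carrier
    forced n w = c⁻¹ ⊗ (g n - sumTo d (λ m → c m ⊗ w m))

    complete : ℕ → (ℕ → Carrier) → ℕ → Carrier
    complete n w m = if does (m <? d) then w m else forced n w

    -- window n m is ξ (n + m), for m ≤ d
    window : ℕ → ℕ → Carrier
    window zero    = complete 0 init
    window (suc n) = complete (suc n) (λ m → window n (suc m))

    solution : ℕ → Carrier
    solution n = window n 0

    complete-below : ∀ n w {m} → m < d → complete n w m ≡ w m
    complete-below n w {m} m<d rewrite dec-true (m <? d) m<d = ≡.refl

    complete-top : ∀ n w → complete n w d ≈ forced n (complete n w)
    complete-top n w rewrite dec-false (d <? d) (ℕP.<-irrefl ≡.refl) =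
      *-congˡ (+-congˡ (-‿cong (sumTo-cong d (λ m m<d → *-congˡ {c m} (reflexive (≡.sym (complete-below n w m<d)))))))

    window-top : ∀ n → window n d ≈ forced n (window n)
    window-top zero    = complete-top 0 init
    window-top (suc n) = complete-top (suc n) (λ m → window n (suc m))

    -- consecutive windows overlap, so window n m is indeed ξ (n + m)
    solution-window : ∀ n m → m ≤ d → solution (n + m) ≡ window n m
    solution-window n zero    _   = ≡.cong solution (ℕP.+-identityʳ n)
    solution-window n (suc m) m<d =
      ≡.trans (≡.cong solution (ℕP.+-suc n m))
      (≡.trans (solution-window (suc n) m (ℕP.<⇒≤ m<d))
               (complete-below (suc n) (λ k → window n (suc k)) m<d))

    solution-init : ∀ m → m < d → solution m ≡ init m
    solution-init m m<d = ≡.trans (solution-window 0 m (ℕP.<⇒≤ m<d)) (complete-below 0 init m<d)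

    solution-solves : ∀ n → mulTail solution n ≈ g n
    solution-solves n = begin
      sumTo (suc d) (λ m → c m ⊗ solution (n + m))        ≈⟨ sumTo-snoc d (λ m → c m ⊗ solution (n + m)) ⟩
      sumTo d (λ m → c m ⊗ solution (n + m)) ⊕ c d ⊗ solution (n + d)
        ≈⟨ +-cong (sumTo-cong d (λ m m<d → *-congˡ {c m} (reflexive (solution-window n m (ℕP.<⇒≤ m<d)))))
                  (*-congˡ (trans (reflexive (solution-window n d ℕP.≤-refl)) (window-top n))) ⟩
      earlier ⊕ c d ⊗ (c⁻¹ ⊗ (g n - earlier))             ≈⟨ +-congˡ (cancel-lead _) ⟩
      earlier ⊕ (g n - earlier)                           ≈⟨ +-comm _ _ ⟩
      (g n - earlier) ⊕ earlier                           ≈⟨ //-rightDividesˡ earlier (g n) ⟩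
      g n                                                 ∎
      where earlier = sumTo d (λ m → c m ⊗ window n m)

  -- the solution of mulTail ξ = 0 with initial values δ_{b,i} (i < d); the
  -- elements basis 0, …, basis (d-1) span the kernel of ξ ↦ {cξ}
  basis : ℕ → ℕ → Carrier
  basis b = Recurrence.solution (monomial b 1#) (λ _ → 0#)

  basis-kernel : ∀ b n → mulTail (basis b) n ≈ 0#
  basis-kernel b = Recurrence.solution-solves (monomial b 1#) (λ _ → 0#)

  basis-init : ∀ b i → i < d → basis b i ≡ monomial b 1# i
  basis-init b = Recurrence.solution-init (monomial b 1#) (λ _ → 0#)

  record EuclideanDivision (M : ℕ) (Y : ℕ → Carrier) : Set (a Level.⊔ ℓ) where
    field
      quotient remainder : ℕ → Carrier
      quotient-deg       : Supp (M ∸ d) quotient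
      remainder-deg      : Supp M remainder
      remainder-small    : Supp d remainder
      divides            : ∀ n → Y n ≈ mulPoly quotient n ⊕ remainder n

  trivial-division : ∀ {M Y} → M ≤ d → Supp M Y → EuclideanDivision M Y
  trivial-division {M} {Y} M≤d Y-deg = record
    { quotient        = λ _ → 0#
    ; remainder       = Y
    ; quotient-deg    = λ _ _ → refl
    ; remainder-deg   = Y-deg
    ; remainder-small = λ j d≤j → Y-deg j (ℕP.≤-trans M≤d d≤j)
    ; divides         = λ n → sym (trans (+-congʳ (mulPoly-zero n)) (+-identityˡ (Y n)))
    }

  -- the monomial of c⁻¹·Y_M·t^{M-d}, which kills the coefficient of t^M
  leading : ℕ → (ℕ → Carrier) → ℕ → Carrier
  leading M Y = monomial (M ∸ d) (c⁻¹ ⊗ Y M)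

  reduce : ℕ → (ℕ → Carrier) → ℕ → Carrier
  reduce M Y n = Y n - mulPoly (leading M Y) n

  reduce-deg : ∀ {M Y} → d ≤ M → Supp (suc M) Y → Supp M (reduce M Y)
  reduce-deg {M} {Y} d≤M Y-deg j M≤j with j ≟ M
  ... | yes ≡.refl = x≈y⇒x∙y⁻¹≈ε (sym (begin
    mulPoly (leading M Y) M                       ≡⟨ ≡.cong (mulPoly (leading M Y)) (≡.sym M∸d+d) ⟩
    mulPoly (leading M Y) (M ∸ d + d)             ≈⟨ mulPoly-monomial-top (M ∸ d) (c⁻¹ ⊗ Y M) ⟩
    c d ⊗ (c⁻¹ ⊗ Y M)                             ≈⟨ cancel-lead (Y M) ⟩
    Y M                                           ∎))
    where M∸d+d = ℕP.m∸n+n≡m d≤M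
  ... | no j≢M = begin
    Y j - mulPoly (leading M Y) j  ≈⟨ +-cong (Y-deg j M<j) (-‿cong (mulPoly-monomial-above (M ∸ d) _ j
                                                         (≡.subst (_< j) (≡.sym (ℕP.m∸n+n≡m d≤M)) M<j))) ⟩
    0# - 0#                        ≈⟨ -‿inverseʳ 0# ⟩
    0#                             ∎
    where M<j = ℕP.≤∧≢⇒< M≤j (j≢M ∘ ≡.sym)

  division-step : ∀ {M Y} → d ≤ M → EuclideanDivision M (reduce M Y) → EuclideanDivision (suc M) Y
  division-step {M} {Y} d≤M D = record
    { quotient        = Q′
    ; remainder       = remainder
    ; quotient-deg    = Q′-deg
    ; remainder-deg   = λ j M<j → remainder-deg j (ℕP.<⇒≤ M<j)
    ; remainder-small = remainder-small
    ; divides         = Y-divides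
    }
    where
    open EuclideanDivision D
    Q′ : ℕ → Carrier
    Q′ j = quotient j ⊕ leading M Y j

    Q′-deg : Supp (suc M ∸ d) Q′
    Q′-deg j p = trans (+-cong (quotient-deg j (ℕP.<⇒≤ j>M∸d)) (monomial-supp (M ∸ d) _ j j>M∸d)) (+-identityʳ 0#)
      where j>M∸d = ≡.subst (_≤ j) (ℕP.+-∸-assoc 1 d≤M) p

    Y-divides : ∀ n → Y n ≈ mulPoly Q′ n ⊕ remainder n
    Y-divides n = begin
      Y n                                                          ≈⟨ sym (//-rightDividesˡ L (Y n)) ⟩
      reduce M Y n ⊕ L                                             ≈⟨ +-congʳ (divides n) ⟩
      (mulPoly quotient n ⊕ remainder n) ⊕ L                       ≈⟨ xy∙z≈xz∙y _ _ _ ⟩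
      (mulPoly quotient n ⊕ L) ⊕ remainder n                       ≈⟨ +-congʳ (sym (mulPoly-⊕ quotient (leading M Y) n)) ⟩
      mulPoly Q′ n ⊕ remainder n                                   ∎
      where L = mulPoly (leading M Y) n

  euclid : ∀ M Y → Supp M Y → EuclideanDivision M Y
  euclid zero    Y Y-deg = trivial-division z≤n Y-deg
  euclid (suc M) Y Y-deg with d ≤? M
  ... | yes d≤M = division-step d≤M (euclid M (reduce M Y) (reduce-deg d≤M Y-deg))
  ... | no  d≰M = trivial-division (ℕP.≰⇒> d≰M) Y-deg

  multiple-orthogonal : ∀ M X → Supp (M ∸ d) X → ∀ b l → pair M (mulPoly X) (basis b) l ≈ 0#
  multiple-orthogonal M X X-deg b l =
    trans (adjoint M X (basis b) l X-deg) (pair-zeroʳ M X (mulTail (basis b)) l (basis-kernel b))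

  pair-basis : ∀ M Y → Supp d Y → ∀ b → b < d → b < M → pair M Y (basis b) 0 ≈ Y b
  pair-basis M Y Y-deg b b<d b<M = begin
    pair M Y (basis b) 0   ≈⟨ sumTo-single M (λ i → Y i ⊗ basis b (i + 0)) b b<M others ⟩
    Y b ⊗ basis b (b + 0)  ≡⟨ ≡.cong (Y b ⊗_) (basis-at b b (ℕP.+-identityʳ b) b<d) ⟩
    Y b ⊗ monomial b 1# b  ≡⟨ ≡.cong (Y b ⊗_) (monomial-at b 1#) ⟩
    Y b ⊗ 1#               ≈⟨ *-identityʳ (Y b) ⟩
    Y b                    ∎
    where
    basis-at : ∀ b i {j} → j ≡ i → i < d → basis b j ≡ monomial b 1# i
    basis-at b i ≡.refl i<d = basis-init b i i<d

    others : ∀ i → i < M → i ≢ b → Y i ⊗ basis b (i + 0) ≈ 0#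
    others i _ i≢b with i <? d
    ... | yes i<d = trans (*-congˡ (reflexive (≡.trans (basis-at b i (ℕP.+-identityʳ i) i<d)
                                                       (monomial-off b i 1# i≢b))))
                          (zeroʳ (Y i))
    ... | no  i≮d = trans (*-congʳ (Y-deg i (ℕP.≮⇒≥ i≮d))) (zeroˡ _)

  -- a polynomial Y of degree < M orthogonal to the kernel basis is a multiple
  -- c·X with deg X < M − d: its remainder modulo c vanishes
  divisible : ∀ M Y → Supp M Y → (∀ b → b < d → pair M Y (basis b) 0 ≈ 0#) →
              Σ (ℕ → Carrier) λ X → Supp (M ∸ d) X × (∀ n → Y n ≈ mulPoly X n)
  divisible M Y Y-deg Y⊥basis =
    quotient , quotient-deg , λ n → trans (divides n) (trans (+-congˡ (remainder-zero n)) (+-identityʳ _))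
    where
    open EuclideanDivision (euclid M Y Y-deg)
    remainder-zero : ∀ b → remainder b ≈ 0#
    remainder-zero b with b <? d | b <? M
    ... | no  b≮d | _       = remainder-small b (ℕP.≮⇒≥ b≮d)
    ... | yes _   | no  b≮M = remainder-deg b (ℕP.≮⇒≥ b≮M)
    ... | yes b<d | yes b<M = begin
      remainder b
        ≈⟨ sym (pair-basis M remainder remainder-small b b<d b<M) ⟩
      pair M remainder (basis b) 0
        ≈⟨ sym (+-identityˡ _) ⟩
      0# ⊕ pair M remainder (basis b) 0
        ≈⟨ +-congʳ (sym (multiple-orthogonal M quotient quotient-deg b 0)) ⟩
      pair M (mulPoly quotient) (basis b) 0 ⊕ pair M remainder (basis b) 0
        ≈⟨ sym (pair-⊕ M (mulPoly quotient) remainder (basis b) 0) ⟩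
      pair M (λ j → mulPoly quotient j ⊕ remainder j) (basis b) 0
        ≈⟨ sym (pair-cong M (basis b) 0 (λ j _ → divides j)) ⟩
      pair M Y (basis b) 0
        ≈⟨ Y⊥basis b b<d ⟩
      0# ∎

maxFin-cong : ∀ n {f g : Fin n → ℕ} → (∀ i → f i ≡ g i) → maxFin n f ≡ maxFin n g
maxFin-cong zero    f≡g = ≡.refl
maxFin-cong (suc n) f≡g = ≡.cong₂ _⊔_ (f≡g fz) (maxFin-cong n (f≡g ∘ fs))

maxFin-bound : ∀ n (f : Fin n → ℕ) i → f i ≤ maxFin n f
maxFin-bound (suc n) f fz     = ℕP.m≤m⊔n _ _
maxFin-bound (suc n) f (fs i) = ℕP.≤-trans (maxFin-bound n (f ∘ fs) i) (ℕP.m≤n⊔m _ _)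

maxFin-++ : ∀ m n (f : Fin m → ℕ) (g : Fin n → ℕ) → maxFin (m + n) (f ++ g) ≡ maxFin m f ⊔ maxFin n g
maxFin-++ zero    n f g = ≡.refl
maxFin-++ (suc m) n f g = ≡.trans
  (≡.cong (f fz ⊔_) (≡.trans (maxFin-cong (m + n) tail-++) (maxFin-++ m n (f ∘ fs) g)))
  (≡.sym (ℕP.⊔-assoc (f fz) _ _))
  where
  tail-++ : ∀ i → (f ++ g) (fs i) ≡ ((f ∘ fs) ++ g) i
  tail-++ i with splitAt m i
  ... | inj₁ _ = ≡.refl
  ... | inj₂ _ = ≡.refl

maxFin-replicate : ∀ n k → maxFin n (replicate n k) ≤ k
maxFin-replicate zero    k = z≤n
maxFin-replicate (suc n) k = ℕP.⊔-lub ℕP.≤-refl (maxFin-replicate n k)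

module Coefficients {q : ℕ} (F : FiniteField q) (N : ℕ) where
  open FiniteField F using (commRing)
  open CommutativeRing commRing renaming (_+_ to _⊕_; _*_ to _⊗_)
  open Bohr F N
  open Sequences commRing

  coeff-below : ∀ (x : G) {j} (j<N : j < N) → coeff x j ≡ x (fromℕ< j<N)
  coeff-below x {j} j<N with suc j ≤? N
  ... | yes _   = ≡.refl
  ... | no  j≮N = contradiction j<N j≮N

  coeff-above : ∀ (x : G) {j} → N ≤ j → coeff x j ≡ 0#
  coeff-above x {j} N≤j with suc j ≤? N
  ... | yes j<N = contradiction N≤j (ℕP.<⇒≱ j<N)
  ... | no  _   = ≡.refl

  coeff-toℕ : ∀ (x : G) i → coeff x (toℕ i) ≡ x i
  coeff-toℕ x i = ≡.trans (coeff-below x (FinP.toℕ<n i)) (≡.cong x (FinP.fromℕ<-toℕ i (FinP.toℕ<n i)))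

  coeff-deg : ∀ (x : G) M → InG M x → Supp M (coeff x)
  coeff-deg x M x∈G_M j M≤j with suc j ≤? N
  ... | yes j<N = x∈G_M (fromℕ< j<N) (≡.subst (M ≤_) (≡.sym (FinP.toℕ-fromℕ< j<N)) M≤j)
  ... | no  _   = refl

  coeff-deg-N : ∀ (x : G) → Supp N (coeff x)
  coeff-deg-N x j N≤j = reflexive (coeff-above x N≤j)

  fromSeq : (ℕ → Carrier) → G
  fromSeq X i = X (toℕ i)

  coeff-fromSeq : ∀ X → Supp N X → ∀ j → coeff (fromSeq X) j ≈ X j
  coeff-fromSeq X X-deg j with ℕP.<-≤-connex j N
  ... | inj₁ j<N = reflexive (≡.trans (coeff-below (fromSeq X) j<N) (≡.cong X (FinP.toℕ-fromℕ< j<N)))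
  ... | inj₂ N≤j = trans (reflexive (coeff-above (fromSeq X) N≤j)) (sym (X-deg j N≤j))

  ∑-sumTo : ∀ n (f : Fin n → Carrier) (g : ℕ → Carrier) → (∀ i → f i ≈ g (toℕ i)) → ∑ n f ≈ sumTo n g
  ∑-sumTo zero    f g f≈g = refl
  ∑-sumTo (suc n) f g f≈g = +-cong (f≈g fz) (∑-sumTo n (f ∘ fs) (g ∘ suc) (f≈g ∘ fs))

  fracCoeff-pair : ∀ (x : G) ξ l → fracCoeff x ξ l ≈ pair N (coeff x) ξ l
  fracCoeff-pair x ξ l = ∑-sumTo N _ (λ j → coeff x j ⊗ ξ (j + l))
                                   (λ i → *-congʳ (reflexive (≡.sym (coeff-toℕ x i))))

  InBohr-++ : ∀ m n (Γ₁ : Fin m → 𝕋) (Γ₂ : Fin n → 𝕋) κ₁ κ₂ y →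
              InBohr (m + n) (Γ₁ ++ Γ₂) (κ₁ ++ κ₂) y ⇔ (InBohr m Γ₁ κ₁ y × InBohr n Γ₂ κ₂ y)
  InBohr-++ m n Γ₁ Γ₂ κ₁ κ₂ y = mk⇔
    (λ y∈B → (λ s → ≡.subst₂ (degFracBelow y) (lookup-++ˡ Γ₁ Γ₂ s) (lookup-++ˡ κ₁ κ₂ s) (y∈B (s ↑ˡ n)))
           , (λ s → ≡.subst₂ (degFracBelow y) (lookup-++ʳ Γ₁ Γ₂ s) (lookup-++ʳ κ₁ κ₂ s) (y∈B (m ↑ʳ s))))
    (λ (y∈B₁ , y∈B₂) → both y∈B₁ y∈B₂)
    where
    both : InBohr m Γ₁ κ₁ y → InBohr n Γ₂ κ₂ y → InBohr (m + n) (Γ₁ ++ Γ₂) (κ₁ ++ κ₂) y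
    both y∈B₁ y∈B₂ i with splitAt m i
    ... | inj₁ s = y∈B₁ s
    ... | inj₂ s = y∈B₂ s

-- A Bohr set of width 0 is all of G (N ≥ 1); it lies in G_{N-d} only if d = 0.
width-positive : ∀ {q} (F : FiniteField q) N → 1 ≤ N → ∀ d r Γ (κ : Fin r → ℕ) →
                 Bohr.width F N r κ ≡ 0 →
                 (∀ x → Bohr.InBohr F N r Γ κ x → Bohr.InG F N (N ∸ d) x) → d ≡ 0
width-positive F N       _   zero     r Γ κ _      _    = ≡.refl
width-positive F (suc N) _   (suc d) r Γ κ width≡0 B⊆G =
  contradiction (sym (B⊆G (λ _ → 1#) everything (fromℕ N) N∸d≤N)) 0≉1
  where
  open FiniteField F using (1#; sym; 0≉1)
  everything : Bohr.InBohr F (suc N) r Γ κ (λ _ → 1#)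
  everything s l l<κ = contradiction (ℕP.<-≤-trans l<κ (≡.subst (κ s ≤_) width≡0 (maxFin-bound r κ s))) ℕP.n≮0
  N∸d≤N : N ∸ d ≤ toℕ (fromℕ N)
  N∸d≤N = ≡.subst (N ∸ d ≤_) (≡.sym (FinP.toℕ-fromℕ N)) (ℕP.m∸n≤m N d)

module Dilation {q : ℕ} (F : FiniteField q) (N d : ℕ) (c : Fin (suc d) → FiniteField.Carrier F)
                (c-lead : ¬ FiniteField._≈_ F (c (fromℕ d)) (FiniteField.0# F)) where
  open FiniteField F using (commRing; inverse)
  open CommutativeRing commRing renaming (_+_ to _⊕_; _*_ to _⊗_)
  open Bohr F N
  open Sequences commRing
  open Coefficients F N
  open import Relation.Binary.Reasoning.Setoid setoid

  ĉ : ℕ → Carrier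
  ĉ = Bohr.coeff F (suc d) c

  ĉ-toℕ : ∀ i → ĉ (toℕ i) ≡ c i
  ĉ-toℕ = Coefficients.coeff-toℕ F (suc d) c

  ĉ-lead : ¬ ĉ d ≈ 0#
  ĉ-lead ĉ_d≈0 = c-lead (trans (reflexive (≡.sym (≡.trans (≡.cong ĉ (≡.sym (FinP.toℕ-fromℕ d))) (ĉ-toℕ (fromℕ d)))))
                               ĉ_d≈0)

  open Multiplication commRing d ĉ
  open DivisionBy commRing d ĉ (proj₁ (inverse (ĉ d) ĉ-lead)) (proj₂ (inverse (ĉ d) ĉ-lead))

  mul-mulPoly : ∀ (x : G) n → mul d c x n ≈ mulPoly (coeff x) (toℕ n)
  mul-mulPoly x n = ∑-sumTo (suc d) _ (λ i → guard i (toℕ n) (ĉ i ⊗ coeff x (toℕ n ∸ i)))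
    (λ i → guard-cong (toℕ i) (toℕ n) (*-congʳ (reflexive (≡.sym (ĉ-toℕ i)))))

  mul-coeff : ∀ (x y : G) → (∀ n → y n ≈ mul d c x n) → ∀ j → j < N → coeff y j ≈ mulPoly (coeff x) j
  mul-coeff x y y≈cx j j<N = begin
    coeff y j                                   ≡⟨ coeff-below y j<N ⟩
    y (fromℕ< j<N)                              ≈⟨ y≈cx (fromℕ< j<N) ⟩
    mul d c x (fromℕ< j<N)                      ≈⟨ mul-mulPoly x (fromℕ< j<N) ⟩
    mulPoly (coeff x) (toℕ (fromℕ< j<N))        ≡⟨ ≡.cong (mulPoly (coeff x)) (FinP.toℕ-fromℕ< j<N) ⟩
    mulPoly (coeff x) j                         ∎

  transfer : ∀ (x y : G) → Supp (N ∸ d) (coeff x) → (∀ n → y n ≈ mul d c x n) →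
             ∀ ξ l → fracCoeff y ξ l ≈ pair N (coeff x) (mulTail ξ) l
  transfer x y x-deg y≈cx ξ l = begin
    fracCoeff y ξ l                   ≈⟨ fracCoeff-pair y ξ l ⟩
    pair N (coeff y) ξ l              ≈⟨ pair-cong N ξ l (mul-coeff x y y≈cx) ⟩
    pair N (mulPoly (coeff x)) ξ l    ≈⟨ adjoint N (coeff x) ξ l x-deg ⟩
    pair N (coeff x) (mulTail ξ) l    ∎

  preimage : 𝕋 → 𝕋
  preimage γ = Recurrence.solution (λ _ → 0#) γ

  preimage-condition : ∀ (x y : G) → Supp (N ∸ d) (coeff x) → (∀ n → y n ≈ mul d c x n) →
                       ∀ γ κ → degFracBelow y (preimage γ) κ ⇔ degFracBelow x γ κ
  preimage-condition x y x-deg y≈cx γ κ =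
    mk⇔ (λ y∈B l l<κ → trans (sym (same l)) (y∈B l l<κ)) (λ x∈B l l<κ → trans (same l) (x∈B l l<κ))
    where
    same : ∀ l → fracCoeff y (preimage γ) l ≈ fracCoeff x γ l
    same l = begin
      fracCoeff y (preimage γ) l                 ≈⟨ transfer x y x-deg y≈cx (preimage γ) l ⟩
      pair N (coeff x) (mulTail (preimage γ)) l  ≈⟨ pair-congʳ N (coeff x) l (Recurrence.solution-solves (λ _ → 0#) γ) ⟩
      pair N (coeff x) γ l                       ≈⟨ sym (fracCoeff-pair x γ l) ⟩
      fracCoeff x γ l                            ∎

  basis-condition : ∀ (x y : G) → Supp (N ∸ d) (coeff x) → (∀ n → y n ≈ mul d c x n) →
                    ∀ b κ → degFracBelow y (basis b) κ
  basis-condition x y x-deg y≈cx b κ l _ =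
    trans (transfer x y x-deg y≈cx (basis b) l) (pair-zeroʳ N (coeff x) _ l (basis-kernel b))

  frequencies : ∀ {r} → (Fin r → 𝕋) → Fin (r + d) → 𝕋
  frequencies Γ = (preimage ∘ Γ) ++ (basis ∘ toℕ)

  radii : ∀ {r} → (Fin r → ℕ) → ℕ → Fin (r + d) → ℕ
  radii κ k = κ ++ replicate d k

  radii-width : ∀ r κ k → width r κ ≡ k → width (r + d) (radii κ k) ≡ k
  radii-width r κ k width≡k = ≡.trans (maxFin-++ r d κ (replicate d k))
    (≡.trans (≡.cong (_⊔ _) width≡k) (ℕP.m≥n⇒m⊔n≡m (maxFin-replicate d k)))

  dilate-Bohr : 1 ≤ N → ∀ r Γ κ k → width r κ ≡ k → (∀ x → InBohr r Γ κ x → InG (N ∸ d) x) →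
                ∀ (y : G) → InBohr (r + d) (frequencies Γ) (radii κ k) y ⇔
                            (Σ G λ x → InBohr r Γ κ x × (∀ n → y n ≈ mul d c x n))
  dilate-Bohr 1≤N r Γ κ k width≡k B⊆G y = mk⇔ from-Bohr to-Bohr
    where
    split : InBohr (r + d) (frequencies Γ) (radii κ k) y ⇔
            (InBohr r (preimage ∘ Γ) κ y × InBohr d (basis ∘ toℕ) (replicate d k) y)
    split = InBohr-++ r d (preimage ∘ Γ) (basis ∘ toℕ) κ (replicate d k) y

    to-Bohr : (Σ G λ x → InBohr r Γ κ x × (∀ n → y n ≈ mul d c x n)) →
              InBohr (r + d) (frequencies Γ) (radii κ k) y
    to-Bohr (x , x∈B , y≈cx) = Equivalence.from split
      ( (λ s → Equivalence.from (preimage-condition x y x-deg y≈cx (Γ s) (κ s)) (x∈B s))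
      , (λ s → basis-condition x y x-deg y≈cx (toℕ s) k) )
      where
      x-deg : Supp (N ∸ d) (coeff x)
      x-deg = coeff-deg x (N ∸ d) (B⊆G x x∈B)

    from-Bohr : InBohr (r + d) (frequencies Γ) (radii κ k) y →
                Σ G λ x → InBohr r Γ κ x × (∀ n → y n ≈ mul d c x n)
    from-Bohr y∈B′ = x , (λ s → Equivalence.to (preimage-condition x y x-deg y≈cx (Γ s) (κ s)) (y∈B₁ s)) , y≈cx
      where
      y∈B₁ : InBohr r (preimage ∘ Γ) κ y
      y∈B₁ = proj₁ (Equivalence.to split y∈B′)

      y∈B₂ : InBohr d (basis ∘ toℕ) (replicate d k) y
      y∈B₂ = proj₂ (Equivalence.to split y∈B′)

      -- the kernel conditions are not vacuous: d ≥ 1 forces k ≥ 1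

      k-positive : ∀ {b} → b < d → 0 < k
      k-positive b<d = ℕP.n≢0⇒n>0 (λ k≡0 → ℕP.n≮0 (≡.subst (_ <_)
        (width-positive F N 1≤N d r Γ κ (≡.trans width≡k k≡0) B⊆G) b<d))

      -- the conditions at l = 0 say that y is orthogonal to the kernel basis
      y⊥basis : ∀ b → b < d → pair N (coeff y) (basis b) 0 ≈ 0#
      y⊥basis b b<d = trans (sym (fracCoeff-pair y (basis b) 0))
        (≡.subst (λ b′ → degFracBelow y (basis b′) k) (FinP.toℕ-fromℕ< b<d) (y∈B₂ (fromℕ< b<d)) 0 (k-positive b<d))

      quotient : Σ (ℕ → Carrier) λ X → Supp (N ∸ d) X × (∀ n → coeff y n ≈ mulPoly X n)
      quotient = divisible N (coeff y) (coeff-deg-N y) y⊥basis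

      X : ℕ → Carrier
      X = proj₁ quotient

      X-deg : Supp (N ∸ d) X
      X-deg = proj₁ (proj₂ quotient)

      x : G
      x = fromSeq X

      coeff-x : ∀ j → coeff x j ≈ X j
      coeff-x = coeff-fromSeq X (λ j N≤j → X-deg j (ℕP.≤-trans (ℕP.m∸n≤m N d) N≤j))

      x-deg : Supp (N ∸ d) (coeff x)
      x-deg j N∸d≤j = trans (coeff-x j) (X-deg j N∸d≤j)

      y≈cx : ∀ n → y n ≈ mul d c x n
      y≈cx n = begin
        y n                               ≡⟨ coeff-toℕ y n ⟨
        coeff y (toℕ n)                   ≈⟨ proj₂ (proj₂ quotient) (toℕ n) ⟩
        mulPoly X (toℕ n)                 ≈⟨ mulPoly-cong (λ j → sym (coeff-x j)) (toℕ n) ⟩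
        mulPoly (coeff x) (toℕ n)         ≈⟨ mul-mulPoly x n ⟨
        mul d c x n                       ∎

lemma2p1 : (p e q : ℕ) → Prime p → q ≡ p ^ suc e → (F : FiniteField q) →
    (N : ℕ) → 1 ≤ N →
    let open FiniteField F using (_≈_) in let open Bohr F N in
    (d : ℕ) (c : Poly (suc d)) → NonzeroOfDeg d c →
    (r : ℕ) (Γ : Fin r → 𝕋) (κ : Fin r → ℕ) (k : ℕ) → width r κ ≡ k →
    (∀ x → InBohr r Γ κ x → InG (N ∸ d) x) →
    Σ ℕ λ r′ → r′ ≤ r + q ^ d × Σ (Fin r′ → 𝕋) λ Γ′ → Σ (Fin r′ → ℕ) λ κ′ →
      width r′ κ′ ≡ k ×
      (∀ (y : G) → InBohr r′ Γ′ κ′ y ⇔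
        (Σ G λ x → InBohr r Γ κ x × (∀ n → y n ≈ mul d c x n)))
lemma2p1 p e q p-prime q≡p^e+1 F N 1≤N d c c-lead r Γ κ k width≡k B⊆G =
  r + d , ℕP.+-monoʳ-≤ r (ℕP.<⇒≤ (<-pow q 1<q d)) ,
  frequencies Γ , radii κ k ,
  radii-width r κ k width≡k ,
  dilate-Bohr 1≤N r Γ κ k width≡k B⊆G
  where
  open Dilation F N d c c-lead
  1<q : 1 < q
  1<q = ≡.subst (1 <_) (≡.sym q≡p^e+1)
          (ℕP.^-monoʳ-< p (nonTrivial⇒n>1 p {{prime⇒nonTrivial p-prime}}) {0} {suc e} (s≤s z≤n))
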